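{- Let $G$ be a graph with $n$ vertices, $m$ edges and maximum degree $\Delta\geq 1$. Then the number of cliques of $G$ satisfies \[c(G)\leq 1+n+\left(\frac{2^{\Delta+1}-\Delta-2}{\binom{\Delta+1}{2}}\right)m\leq 1+\left(\frac{2^{\Delta+1}-1}{\Delta+1}\right)n.\]
   Context: All graphs are finite, simple and undirected. A clique is a (possibly empty) set of pairwise adjacent vertices; $c(G)$ denotes the number of cliques of $G$ (including $\emptyset$ and single vertices). -}

module Defs where

open import Data.Nat using (ℕ; zero; suc; _<_; _⊔_)
open import Data.Nat.Properties using (_<?_)
open import Data.Bool using (Bool; true; false; T)
open import Data.Fin using (Fin; toℕ; _≟_)
open import Data.Fin.Properties using (all?)
open import Data.Fin.Subset using (Subset; _∈_; ⊥)
open import Data.Fin.Subset.Properties using (_∈?_)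
open import Data.Vec as V using ()
open import Data.List using (List; []; _∷_; map; _++_; length; filter; allFin; foldr; cartesianProduct)
open import Data.Product using (_×_; _,_; proj₁; proj₂)
open import Relation.Nullary using (¬_; Dec)
open import Relation.Nullary.Decidable using (T?; _→-dec_; ¬?; _×-dec_)
open import Relation.Binary.PropositionalEquality using (_≡_; _≢_)

record Graph (n : ℕ) : Set where
  field
    adj     : Fin n → Fin n → Bool
    symm    : ∀ i j → adj i j ≡ adj j i
    irrefl  : ∀ i → adj i i ≡ false

open Graph public

Adj : ∀ {n} → Graph n → Fin n → Fin n → Set
Adj G i j = T (adj G i j)

IsClique : ∀ {n} → Graph n → Subset n → Set
IsClique {n} G S = ∀ (i j : Fin n) → i ∈ S → j ∈ S → i ≢ j → Adj G i j

isClique? : ∀ {n} (G : Graph n) (S : Subset n) → Dec (IsClique G S)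
isClique? G S =
  all? λ i → all? λ j →
    (i ∈? S) →-dec ((j ∈? S) →-dec (¬? (i ≟ j) →-dec T? (adj G i j)))

allSubsets : ∀ n → List (Subset n)
allSubsets zero    = V.[] ∷ []
allSubsets (suc n) = map (true V.∷_) (allSubsets n) ++ map (false V.∷_) (allSubsets n)

-- c(G): number of cliques (including ∅ and singletons).
numCliques : ∀ {n} → Graph n → ℕ
numCliques G = length (filter (isClique? G) (allSubsets _))

numEdges : ∀ {n} → Graph n → ℕ
numEdges {n} G =
  length (filter (λ p → (toℕ (proj₁ p) <? toℕ (proj₂ p)) ×-dec T? (adj G (proj₁ p) (proj₂ p)))
                 (cartesianProduct (allFin n) (allFin n)))

degree : ∀ {n} → Graph n → Fin n → ℕ
degree {n} G v = length (filter (λ u → T? (adj G v u)) (allFin n))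

maxDegree : ∀ {n} → Graph n → ℕ
maxDegree {n} G = foldr (λ v acc → degree G v ⊔ acc) 0 (allFin n)

-- Write c_k for the number of k-cliques. The vertices of a k-clique through an edge ij other
-- than i and j are common neighbours of i and j, and i has at most Δ - 1 neighbours besides j,
-- so every edge lies in at most C(Δ-1, k-2) k-cliques. Double counting pairs (k-clique, edge
-- inside it) gives C(k,2) c_k ≤ m C(Δ-1, k-2), and the identity
-- C(Δ+1,2) C(Δ-1,k-2) = C(k,2) C(Δ+1,k) turns this into C(Δ+1,2) c_k ≤ m C(Δ+1,k) for k ≥ 2.
-- Summing over k with c_0 = 1, c_1 = n and Σ_{k≥2} C(Δ+1,k) = 2^(Δ+1) - Δ - 2 gives the first
-- inequality; the second one follows from the handshake bound 2m ≤ nΔ.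

module Submission where

open import Data.Nat using (ℕ; zero; suc; _≤_; _<_; _+_; _*_; _∸_; _^_; _⊔_; _≡ᵇ_; _<ᵇ_; z≤n; s≤s; >-nonZero)
open import Data.Nat.Properties hiding (_≟_)
open import Data.Nat.Solver using (module +-*-Solver)
open import Data.Nat.Combinatorics using (_C_; nC1≡n; nCk+nC[k+1]≡[n+1]C[k+1])
open import Data.Bool using (Bool; true; false; _∧_; _∨_; not; T; if_then_else_)
open import Data.Bool.Properties using (∧-zeroʳ; T-∧; T-≡)
open import Data.Fin using (Fin; toℕ; _≟_) renaming (zero to fzero; suc to fsuc)
open import Data.Fin.Subset using (Subset; ∣_∣)
open import Data.Fin.Subset.Properties using (∣p∣≤n)
open import Data.Vec using (Vec; []; _∷_; lookup; replicate; tabulate; countᵇ)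
open import Data.Vec.Properties using (lookup⇒[]=)
open import Data.List as List using (List; []; _∷_; map; _++_; length; filter; foldr; allFin; upTo; cartesianProduct)
open import Data.List.Properties using (map-tabulate; map-upTo; upTo-∷ʳ; length-tabulate)
open import Data.List.Membership.Propositional using (_∈_)
open import Data.List.Membership.Propositional.Properties using (∈-allFin)
open import Data.List.Relation.Unary.Any using (here; there)
open import Data.Product using (_×_; _,_; proj₁; proj₂)
open import Function using (Equivalence; _∘_)
open import Relation.Nullary using (does; yes; no; contradiction)
open import Relation.Nullary.Decidable using (T?; toWitness; isYes≗does)
open import Relation.Unary using (Pred; Decidable)
open import Relation.Binary.PropositionalEquality
open import Algebra.Properties.CommutativeSemigroup +-commutativeSemigroup using (interchange)
open import Algebra.Properties.CommutativeSemigroup *-commutativeSemigroup using (x∙yz≈y∙xz)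
open import Defs

open Equivalence using (to; from)

-- Indicators and finite sums

⟦_⟧ : Bool → ℕ
⟦ true ⟧  = 1
⟦ false ⟧ = 0

⟦⟧-mono-≤ : ∀ {a b} → (T a → T b) → ⟦ a ⟧ ≤ ⟦ b ⟧
⟦⟧-mono-≤ {false} _   = z≤n
⟦⟧-mono-≤ {true}  a⇒b with T-≡ .to (a⇒b _)
... | refl = ≤-refl

⟦∧⟧≡* : ∀ a b → ⟦ a ∧ b ⟧ ≡ ⟦ a ⟧ * ⟦ b ⟧
⟦∧⟧≡* true  b = sym (+-identityʳ ⟦ b ⟧)
⟦∧⟧≡* false b = refl

⟦⟧*-monoʳ-≤ : ∀ b {x y} → (T b → x ≤ y) → ⟦ b ⟧ * x ≤ ⟦ b ⟧ * y
⟦⟧*-monoʳ-≤ true  x≤y = *-monoʳ-≤ 1 (x≤y _)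
⟦⟧*-monoʳ-≤ false _   = z≤n

∑ : {A : Set} → List A → (A → ℕ) → ℕ
∑ []       f = 0
∑ (x ∷ xs) f = f x + ∑ xs f

syntax ∑ xs (λ x → e) = ∑[ x ∈ xs ] e

module _ {A : Set} where

  ∑-++ : ∀ (xs ys : List A) f → ∑ (xs ++ ys) f ≡ ∑ xs f + ∑ ys f
  ∑-++ []       ys f = refl
  ∑-++ (x ∷ xs) ys f = trans (cong (f x +_) (∑-++ xs ys f)) (sym (+-assoc (f x) _ _))

  ∑-cong : ∀ (xs : List A) {f g} → (∀ x → f x ≡ g x) → ∑ xs f ≡ ∑ xs g
  ∑-cong []       f≗g = refl
  ∑-cong (x ∷ xs) f≗g = cong₂ _+_ (f≗g x) (∑-cong xs f≗g)

  ∑-mono-≤ : ∀ (xs : List A) {f g} → (∀ x → f x ≤ g x) → ∑ xs f ≤ ∑ xs g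
  ∑-mono-≤ []       f≤g = z≤n
  ∑-mono-≤ (x ∷ xs) f≤g = +-mono-≤ (f≤g x) (∑-mono-≤ xs f≤g)

  ∑-zero : ∀ (xs : List A) → ∑[ x ∈ xs ] 0 ≡ 0
  ∑-zero []       = refl
  ∑-zero (x ∷ xs) = ∑-zero xs

  ∑-const : ∀ (xs : List A) c → ∑[ x ∈ xs ] c ≡ length xs * c
  ∑-const []       c = refl
  ∑-const (x ∷ xs) c = cong (c +_) (∑-const xs c)

  ∑-distrib-+ : ∀ (xs : List A) f g → ∑[ x ∈ xs ] (f x + g x) ≡ ∑ xs f + ∑ xs g
  ∑-distrib-+ []       f g = refl
  ∑-distrib-+ (x ∷ xs) f g =
    trans (cong (f x + g x +_) (∑-distrib-+ xs f g)) (interchange (f x) (g x) (∑ xs f) (∑ xs g))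

  ∑-*ˡ : ∀ (xs : List A) c f → ∑[ x ∈ xs ] (c * f x) ≡ c * ∑ xs f
  ∑-*ˡ []       c f = sym (*-zeroʳ c)
  ∑-*ˡ (x ∷ xs) c f = trans (cong (c * f x +_) (∑-*ˡ xs c f)) (sym (*-distribˡ-+ c (f x) (∑ xs f)))

  ∑-*ʳ : ∀ (xs : List A) f c → ∑[ x ∈ xs ] (f x * c) ≡ ∑ xs f * c
  ∑-*ʳ xs f c = trans (∑-cong xs (λ x → *-comm (f x) c)) (trans (∑-*ˡ xs c f) (*-comm c (∑ xs f)))

  length-filter≡∑ : ∀ {p} {P : Pred A p} (P? : Decidable P) xs →
                    length (filter P? xs) ≡ ∑[ x ∈ xs ] ⟦ does (P? x) ⟧
  length-filter≡∑ P? []       = refl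
  length-filter≡∑ P? (x ∷ xs) with does (P? x)
  ... | true  = cong suc (length-filter≡∑ P? xs)
  ... | false = length-filter≡∑ P? xs

∑-map : {A B : Set} (g : A → B) (xs : List A) (f : B → ℕ) → ∑ (map g xs) f ≡ ∑ xs (f ∘ g)
∑-map g []       f = refl
∑-map g (x ∷ xs) f = cong (f (g x) +_) (∑-map g xs f)

∑-comm : {A B : Set} (xs : List A) (ys : List B) (f : A → B → ℕ) →
         ∑[ x ∈ xs ] ∑[ y ∈ ys ] f x y ≡ ∑[ y ∈ ys ] ∑[ x ∈ xs ] f x y
∑-comm []       ys f = sym (∑-zero ys)
∑-comm (x ∷ xs) ys f =
  trans (cong (∑ ys (f x) +_) (∑-comm xs ys f)) (sym (∑-distrib-+ ys (f x) (λ y → ∑[ x ∈ xs ] f x y)))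

∑-cartesianProduct : {A B : Set} (xs : List A) (ys : List B) (f : A × B → ℕ) →
                     ∑ (cartesianProduct xs ys) f ≡ ∑[ x ∈ xs ] ∑[ y ∈ ys ] f (x , y)
∑-cartesianProduct []       ys f = refl
∑-cartesianProduct (x ∷ xs) ys f =
  trans (∑-++ (map (x ,_) ys) _ f) (cong₂ _+_ (∑-map (x ,_) ys f) (∑-cartesianProduct xs ys f))

∑-allFin-suc : ∀ n f → ∑ (allFin (suc n)) f ≡ f fzero + ∑[ i ∈ allFin n ] f (fsuc i)
∑-allFin-suc n f = cong (f fzero +_) (trans (cong (λ is → ∑ is f) (sym (map-tabulate (λ i → i) fsuc)))
                                            (∑-map fsuc (allFin n) f))

∑-upTo-suc : ∀ n f → ∑ (upTo (suc n)) f ≡ f 0 + ∑[ k ∈ upTo n ] f (suc k)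
∑-upTo-suc n f = cong (f 0 +_) (trans (cong (λ ks → ∑ ks f) (sym (map-upTo suc n))) (∑-map suc (upTo n) f))

∑-upTo-≤-suc : ∀ K f → ∑ (upTo K) f ≤ ∑ (upTo (suc K)) f
∑-upTo-≤-suc K f = begin
  ∑ (upTo K) f                ≤⟨ m≤m+n (∑ (upTo K) f) (f K + 0) ⟩
  ∑ (upTo K) f + ∑ (K ∷ []) f ≡⟨ ∑-++ (upTo K) (K ∷ []) f ⟨
  ∑ (upTo K List.∷ʳ K) f      ≡⟨ cong (λ ks → ∑ ks f) (upTo-∷ʳ K) ⟩
  ∑ (upTo (suc K)) f          ∎
  where open ≤-Reasoning

∑-upTo-∧≡ᵇ : ∀ b {s K} → s < K → ∑[ k ∈ upTo K ] ⟦ b ∧ (s ≡ᵇ k) ⟧ ≡ ⟦ b ⟧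
∑-upTo-∧≡ᵇ false {K = K} _ = ∑-zero (upTo K)
∑-upTo-∧≡ᵇ true {zero}  {suc K} _         = trans (∑-upTo-suc K (λ k → ⟦ 0 ≡ᵇ k ⟧)) (cong suc (∑-zero (upTo K)))
∑-upTo-∧≡ᵇ true {suc s} {suc K} (s≤s s<K) = trans (∑-upTo-suc K (λ k → ⟦ suc s ≡ᵇ k ⟧)) (∑-upTo-∧≡ᵇ true s<K)

∑-allFin-≟ : ∀ {n} (i : Fin n) → ∑[ l ∈ allFin n ] ⟦ does (l ≟ i) ⟧ ≡ 1
∑-allFin-≟ {suc n} fzero    = trans (∑-allFin-suc n (λ l → ⟦ does (l ≟ fzero) ⟧)) (cong suc (∑-zero (allFin n)))
∑-allFin-≟ {suc n} (fsuc i) = trans (∑-allFin-suc n (λ l → ⟦ does (l ≟ fsuc i) ⟧)) (∑-allFin-≟ i)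

-- Binomial coefficients

∑-C≤2^ : ∀ n K → ∑[ k ∈ upTo K ] (n C k) ≤ 2 ^ n
∑-C≤2^ n       zero    = z≤n
∑-C≤2^ zero    (suc K) = ≤-reflexive (trans (∑-upTo-suc K (0 C_)) (cong suc (∑-zero (upTo K))))
∑-C≤2^ (suc n) (suc K) = begin
  ∑[ k ∈ upTo (suc K) ] (suc n C k)                       ≡⟨ ∑-upTo-suc K (suc n C_) ⟩
  1 + ∑[ k ∈ upTo K ] (suc n C suc k)                     ≡⟨ cong suc (∑-cong (upTo K) (λ k → sym (nCk+nC[k+1]≡[n+1]C[k+1] n k))) ⟩
  1 + ∑[ k ∈ upTo K ] (n C k + n C suc k)                 ≡⟨ cong suc (∑-distrib-+ (upTo K) (n C_) (λ k → n C suc k)) ⟩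
  1 + (∑[ k ∈ upTo K ] (n C k) + ∑[ k ∈ upTo K ] (n C suc k)) ≡⟨ cong suc (+-comm (∑[ k ∈ upTo K ] (n C k)) _) ⟩
  1 + ∑[ k ∈ upTo K ] (n C suc k) + ∑[ k ∈ upTo K ] (n C k)  ≡⟨ cong (_+ ∑[ k ∈ upTo K ] (n C k)) (∑-upTo-suc K (n C_)) ⟨
  ∑[ k ∈ upTo (suc K) ] (n C k) + ∑[ k ∈ upTo K ] (n C k)  ≤⟨ +-mono-≤ (∑-C≤2^ n (suc K)) (∑-C≤2^ n K) ⟩
  2 ^ n + 2 ^ n                                           ≡⟨ cong (2 ^ n +_) (sym (+-identityʳ (2 ^ n))) ⟩
  2 ^ suc n                                               ∎
  where open ≤-Reasoning

C-monoˡ-≤ : ∀ {m n} k → m ≤ n → m C k ≤ n C k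
C-monoˡ-≤ zero    _         = ≤-refl
C-monoˡ-≤ (suc k) z≤n       = z≤n
C-monoˡ-≤ {suc m} {suc n} (suc k) (s≤s m≤n) = begin
  suc m C suc k      ≡⟨ nCk+nC[k+1]≡[n+1]C[k+1] m k ⟨
  m C k + m C suc k  ≤⟨ +-mono-≤ (C-monoˡ-≤ k m≤n) (C-monoˡ-≤ (suc k) m≤n) ⟩
  n C k + n C suc k  ≡⟨ nCk+nC[k+1]≡[n+1]C[k+1] n k ⟩
  suc n C suc k      ∎
  where open ≤-Reasoning

[k+1]*[n+1]C[k+1]≡[n+1]*nCk : ∀ n k → suc k * (suc n C suc k) ≡ suc n * (n C k)
[k+1]*[n+1]C[k+1]≡[n+1]*nCk zero    zero    = refl
[k+1]*[n+1]C[k+1]≡[n+1]*nCk zero    (suc k) = *-zeroʳ (suc (suc k))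
[k+1]*[n+1]C[k+1]≡[n+1]*nCk (suc n) zero    = trans (+-identityʳ _) (trans (nC1≡n (suc (suc n))) (sym (*-identityʳ (suc (suc n)))))
[k+1]*[n+1]C[k+1]≡[n+1]*nCk (suc n) (suc k) = begin
  suc (suc k) * (suc (suc n) C suc (suc k))             ≡⟨ cong (suc (suc k) *_) (nCk+nC[k+1]≡[n+1]C[k+1] (suc n) (suc k)) ⟨
  suc (suc k) * (suc n C suc k + suc n C suc (suc k))   ≡⟨ *-distribˡ-+ (suc (suc k)) (suc n C suc k) _ ⟩
  suc n C suc k + suc k * (suc n C suc k) + suc (suc k) * (suc n C suc (suc k))
    ≡⟨ cong₂ (λ x y → suc n C suc k + x + y) ([k+1]*[n+1]C[k+1]≡[n+1]*nCk n k) ([k+1]*[n+1]C[k+1]≡[n+1]*nCk n (suc k)) ⟩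
  suc n C suc k + suc n * (n C k) + suc n * (n C suc k) ≡⟨ +-assoc (suc n C suc k) _ _ ⟩
  suc n C suc k + (suc n * (n C k) + suc n * (n C suc k)) ≡⟨ cong (suc n C suc k +_) (*-distribˡ-+ (suc n) (n C k) (n C suc k)) ⟨
  suc n C suc k + suc n * (n C k + n C suc k)           ≡⟨ cong (λ x → suc n C suc k + suc n * x) (nCk+nC[k+1]≡[n+1]C[k+1] n k) ⟩
  suc (suc n) * (suc n C suc k)                         ∎
  where open ≡-Reasoning

2*[n+2]C2≡[n+2]*[n+1] : ∀ n → 2 * (suc (suc n) C 2) ≡ suc (suc n) * suc n
2*[n+2]C2≡[n+2]*[n+1] n = trans ([k+1]*[n+1]C[k+1]≡[n+1]*nCk (suc n) 1) (cong (suc (suc n) *_) (nC1≡n (suc n)))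

[n+2]C2*nCk≡[k+2]C2*[n+2]C[k+2] : ∀ n k →
  (suc (suc n) C 2) * (n C k) ≡ (suc (suc k) C 2) * (suc (suc n) C suc (suc k))
[n+2]C2*nCk≡[k+2]C2*[n+2]C[k+2] n k = *-cancelˡ-≡ _ _ 2 (begin
  2 * ((suc (suc n) C 2) * (n C k))                  ≡⟨ *-assoc 2 (suc (suc n) C 2) (n C k) ⟨
  2 * (suc (suc n) C 2) * (n C k)                  ≡⟨ cong (_* (n C k)) (2*[n+2]C2≡[n+2]*[n+1] n) ⟩
  suc (suc n) * suc n * (n C k)                    ≡⟨ *-assoc (suc (suc n)) (suc n) (n C k) ⟩
  suc (suc n) * (suc n * (n C k))                  ≡⟨ cong (suc (suc n) *_) ([k+1]*[n+1]C[k+1]≡[n+1]*nCk n k) ⟨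
  suc (suc n) * (suc k * (suc n C suc k))          ≡⟨ x∙yz≈y∙xz (suc (suc n)) (suc k) (suc n C suc k) ⟩
  suc k * (suc (suc n) * (suc n C suc k))          ≡⟨ cong (suc k *_) ([k+1]*[n+1]C[k+1]≡[n+1]*nCk (suc n) (suc k)) ⟨
  suc k * (suc (suc k) * (suc (suc n) C suc (suc k))) ≡⟨ x∙yz≈y∙xz (suc k) (suc (suc k)) (suc (suc n) C suc (suc k)) ⟩
  suc (suc k) * (suc k * (suc (suc n) C suc (suc k))) ≡⟨ *-assoc (suc (suc k)) (suc k) (suc (suc n) C suc (suc k)) ⟨
  suc (suc k) * suc k * (suc (suc n) C suc (suc k))   ≡⟨ cong (_* (suc (suc n) C suc (suc k))) (2*[n+2]C2≡[n+2]*[n+1] k) ⟨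
  2 * (suc (suc k) C 2) * (suc (suc n) C suc (suc k)) ≡⟨ *-assoc 2 (suc (suc k) C 2) (suc (suc n) C suc (suc k)) ⟩
  2 * ((suc (suc k) C 2) * (suc (suc n) C suc (suc k))) ∎)
  where open ≡-Reasoning

0<[k+2]C2 : ∀ k → 0 < suc (suc k) C 2
0<[k+2]C2 k = begin-strict
  0                          <⟨ s≤s z≤n ⟩
  suc k                      ≡⟨ nC1≡n (suc k) ⟨
  suc k C 1                  ≤⟨ m≤m+n (suc k C 1) (suc k C 2) ⟩
  suc k C 1 + suc k C 2      ≡⟨ nCk+nC[k+1]≡[n+1]C[k+1] (suc k) 1 ⟩
  suc (suc k) C 2            ∎
  where open ≤-Reasoning

2+n+∑C[2+k]≤2^[1+n] : ∀ n K → 2 + n + ∑[ k ∈ upTo K ] (suc n C (2 + k)) ≤ 2 ^ suc n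
2+n+∑C[2+k]≤2^[1+n] n K = begin
  2 + n + ∑[ k ∈ upTo K ] (suc n C (2 + k))                 ≡⟨ cong (λ x → 1 + (x + ∑[ k ∈ upTo K ] (suc n C (2 + k)))) (nC1≡n (suc n)) ⟨
  1 + (suc n C 1 + ∑[ k ∈ upTo K ] (suc n C (2 + k)))       ≡⟨ cong suc (∑-upTo-suc K (λ k → suc n C suc k)) ⟨
  1 + ∑[ k ∈ upTo (suc K) ] (suc n C suc k)                 ≡⟨ ∑-upTo-suc (suc K) (suc n C_) ⟨
  ∑[ k ∈ upTo (2 + K) ] (suc n C k)                         ≤⟨ ∑-C≤2^ (suc n) (2 + K) ⟩
  2 ^ suc n                                                 ∎
  where open ≤-Reasoning

-- Counting subsets

∑-allSubsets-suc : ∀ n f → ∑ (allSubsets (suc n)) f ≡ ∑[ S ∈ allSubsets n ] f (true ∷ S) + ∑[ S ∈ allSubsets n ] f (false ∷ S)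
∑-allSubsets-suc n f = trans (∑-++ (map (true ∷_) (allSubsets n)) _ f)
                             (cong₂ _+_ (∑-map _ (allSubsets n) f) (∑-map _ (allSubsets n) f))

∣b∷S∣≡⟦b⟧+∣S∣ : ∀ {n} b (S : Subset n) → ∣ b ∷ S ∣ ≡ ⟦ b ⟧ + ∣ S ∣
∣b∷S∣≡⟦b⟧+∣S∣ true  S = refl
∣b∷S∣≡⟦b⟧+∣S∣ false S = refl

∑-lookup≡∣∣ : ∀ {n} (S : Subset n) → ∑[ i ∈ allFin n ] ⟦ lookup S i ⟧ ≡ ∣ S ∣
∑-lookup≡∣∣ []            = refl
∑-lookup≡∣∣ {suc n} (b ∷ S) = begin
  ∑[ i ∈ allFin (suc n) ] ⟦ lookup (b ∷ S) i ⟧   ≡⟨ ∑-allFin-suc n (λ i → ⟦ lookup (b ∷ S) i ⟧) ⟩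
  ⟦ b ⟧ + ∑[ i ∈ allFin n ] ⟦ lookup S i ⟧       ≡⟨ cong (⟦ b ⟧ +_) (∑-lookup≡∣∣ S) ⟩
  ⟦ b ⟧ + ∣ S ∣                                  ≡⟨ ∣b∷S∣≡⟦b⟧+∣S∣ b S ⟨
  ∣ b ∷ S ∣                                      ∎
  where open ≡-Reasoning

data Mode : Set where
  required optional excluded : Mode

Pattern : ℕ → Set
Pattern = Vec Mode

admits : Mode → Bool → Bool
admits required b = b
admits optional _ = true
admits excluded b = not b

fits : ∀ {n} → Pattern n → Subset n → Bool
fits []      []      = true
fits (μ ∷ p) (b ∷ S) = admits μ b ∧ fits p S

isRequired isOptional : Mode → Bool
isRequired required = true
isRequired _        = false
isOptional optional = true
isOptional _        = false

#required #optional : ∀ {n} → Pattern n → ℕ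
#required = countᵇ isRequired
#optional = countᵇ isOptional

∣_∩optional_∣ : ∀ {n} → Subset n → Pattern n → ℕ
∣ []    ∩optional []    ∣ = 0
∣ b ∷ S ∩optional μ ∷ p ∣ = ⟦ isOptional μ ∧ b ⟧ + ∣ S ∩optional p ∣

∑-fits≡C : ∀ {n} (p : Pattern n) r →
  ∑[ S ∈ allSubsets n ] ⟦ fits p S ∧ (∣ S ∩optional p ∣ ≡ᵇ r) ⟧ ≡ #optional p C r
∑-fits≡C []                 zero    = refl
∑-fits≡C []                 (suc r) = refl
∑-fits≡C {suc n} (required ∷ p) r = trans (∑-allSubsets-suc n _)
  (trans (cong₂ _+_ (∑-fits≡C p r) (∑-zero (allSubsets n))) (+-identityʳ _))
∑-fits≡C {suc n} (excluded ∷ p) r = trans (∑-allSubsets-suc n _) (cong₂ _+_ (∑-zero (allSubsets n)) (∑-fits≡C p r))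
∑-fits≡C {suc n} (optional ∷ p) zero = trans (∑-allSubsets-suc n _)
  (cong₂ _+_ (trans (∑-cong (allSubsets n) (λ S → cong ⟦_⟧ (∧-zeroʳ (fits p S)))) (∑-zero (allSubsets n)))
             (∑-fits≡C p zero))
∑-fits≡C {suc n} (optional ∷ p) (suc r) = trans (∑-allSubsets-suc n _)
  (trans (cong₂ _+_ (∑-fits≡C p r) (∑-fits≡C p (suc r))) (nCk+nC[k+1]≡[n+1]C[k+1] (#optional p) r))

fits⇒∣S∣≡#required+∣S∩optional∣ : ∀ {n} (p : Pattern n) (S : Subset n) →
  T (fits p S) → ∣ S ∣ ≡ #required p + ∣ S ∩optional p ∣
fits⇒∣S∣≡#required+∣S∩optional∣ []             []          _  = refl
fits⇒∣S∣≡#required+∣S∩optional∣ (required ∷ p) (true ∷ S)  fs = cong suc (fits⇒∣S∣≡#required+∣S∩optional∣ p S fs)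
fits⇒∣S∣≡#required+∣S∩optional∣ (optional ∷ p) (true ∷ S)  fs =
  trans (cong suc (fits⇒∣S∣≡#required+∣S∩optional∣ p S fs)) (sym (+-suc (#required p) _))
fits⇒∣S∣≡#required+∣S∩optional∣ (optional ∷ p) (false ∷ S) fs = fits⇒∣S∣≡#required+∣S∩optional∣ p S fs
fits⇒∣S∣≡#required+∣S∩optional∣ (excluded ∷ p) (false ∷ S) fs = fits⇒∣S∣≡#required+∣S∩optional∣ p S fs

fits-tabulate : ∀ {n} (f : Fin n → Mode) (S : Subset n) →
  (∀ l → T (admits (f l) (lookup S l))) → T (fits (tabulate f) S)
fits-tabulate {zero}  f []      _  = _
fits-tabulate {suc n} f (b ∷ S) fs =
  T-∧ .from (fs fzero , fits-tabulate (λ l → f (fsuc l)) S (λ l → fs (fsuc l)))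

countᵇ-∷ : ∀ {A : Set} {n} (P : A → Bool) x (xs : Vec A n) → countᵇ P (x ∷ xs) ≡ ⟦ P x ⟧ + countᵇ P xs
countᵇ-∷ P x xs with P x
... | true  = refl
... | false = refl

countᵇ-tabulate : ∀ {A : Set} {n} (P : A → Bool) (f : Fin n → A) →
  countᵇ P (tabulate f) ≡ ∑[ l ∈ allFin n ] ⟦ P (f l) ⟧
countᵇ-tabulate {n = zero}  P f = refl
countᵇ-tabulate {n = suc n} P f = begin
  countᵇ P (tabulate f)                                     ≡⟨ countᵇ-∷ P (f fzero) (tabulate (λ l → f (fsuc l))) ⟩
  ⟦ P (f fzero) ⟧ + countᵇ P (tabulate (λ l → f (fsuc l)))  ≡⟨ cong (⟦ P (f fzero) ⟧ +_) (countᵇ-tabulate P (λ l → f (fsuc l))) ⟩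
  ⟦ P (f fzero) ⟧ + ∑[ l ∈ allFin n ] ⟦ P (f (fsuc l)) ⟧    ≡⟨ ∑-allFin-suc n (λ l → ⟦ P (f l) ⟧) ⟨
  ∑[ l ∈ allFin (suc n) ] ⟦ P (f l) ⟧                       ∎
  where open ≡-Reasoning

∑-∣∣≡C : ∀ n r → ∑[ S ∈ allSubsets n ] ⟦ ∣ S ∣ ≡ᵇ r ⟧ ≡ n C r
∑-∣∣≡C n r = begin
  ∑[ S ∈ allSubsets n ] ⟦ ∣ S ∣ ≡ᵇ r ⟧
    ≡⟨ ∑-cong (allSubsets n) (λ S → cong₂ (λ b s → ⟦ b ∧ (s ≡ᵇ r) ⟧) (fits-all S) (∣∩all∣ S)) ⟨
  ∑[ S ∈ allSubsets n ] ⟦ fits (all n) S ∧ (∣ S ∩optional all n ∣ ≡ᵇ r) ⟧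
    ≡⟨ ∑-fits≡C (all n) r ⟩
  #optional (all n) C r
    ≡⟨ cong (_C r) (#optional-all n) ⟩
  n C r ∎
  where
  open ≡-Reasoning
  all : ∀ m → Pattern m
  all m = replicate m optional
  fits-all : ∀ {m} (S : Subset m) → fits (all m) S ≡ true
  fits-all []      = refl
  fits-all (_ ∷ S) = fits-all S
  ∣∩all∣ : ∀ {m} (S : Subset m) → ∣ S ∩optional all m ∣ ≡ ∣ S ∣
  ∣∩all∣ []          = refl
  ∣∩all∣ (true ∷ S)  = cong suc (∣∩all∣ S)
  ∣∩all∣ (false ∷ S) = ∣∩all∣ S
  #optional-all : ∀ m → #optional (all m) ≡ m
  #optional-all zero    = refl
  #optional-all (suc m) = cong suc (#optional-all m)

∑-pairs≡∣∣C2 : ∀ {n} (S : Subset n) →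
  ∑[ i ∈ allFin n ] ∑[ j ∈ allFin n ] ⟦ (toℕ i <ᵇ toℕ j) ∧ (lookup S i ∧ lookup S j) ⟧ ≡ ∣ S ∣ C 2
∑-pairs≡∣∣C2 []                = refl
∑-pairs≡∣∣C2 {suc n} (b ∷ S) = begin
  ∑[ i ∈ allFin (suc n) ] ∑[ j ∈ allFin (suc n) ] pair (b ∷ S) i j
    ≡⟨ ∑-allFin-suc n (λ i → ∑[ j ∈ allFin (suc n) ] pair (b ∷ S) i j) ⟩
  ∑[ j ∈ allFin (suc n) ] pair (b ∷ S) fzero j + ∑[ i ∈ allFin n ] ∑[ j ∈ allFin (suc n) ] pair (b ∷ S) (fsuc i) j
    ≡⟨ cong₂ _+_ (∑-allFin-suc n (pair (b ∷ S) fzero)) (∑-cong (allFin n) (λ i → ∑-allFin-suc n (pair (b ∷ S) (fsuc i)))) ⟩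
  ∑[ j ∈ allFin n ] ⟦ b ∧ lookup S j ⟧ + ∑[ i ∈ allFin n ] ∑[ j ∈ allFin n ] pair S i j
    ≡⟨ cong (∑[ j ∈ allFin n ] ⟦ b ∧ lookup S j ⟧ +_) (∑-pairs≡∣∣C2 S) ⟩
  ∑[ j ∈ allFin n ] ⟦ b ∧ lookup S j ⟧ + ∣ S ∣ C 2
    ≡⟨ new-pairs b ⟩
  ∣ b ∷ S ∣ C 2 ∎
  where
  open ≡-Reasoning
  pair : ∀ {m} → Subset m → Fin m → Fin m → ℕ
  pair R i j = ⟦ (toℕ i <ᵇ toℕ j) ∧ (lookup R i ∧ lookup R j) ⟧
  new-pairs : ∀ b → ∑[ j ∈ allFin n ] ⟦ b ∧ lookup S j ⟧ + ∣ S ∣ C 2 ≡ ∣ b ∷ S ∣ C 2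
  new-pairs true  = trans (cong (_+ ∣ S ∣ C 2) (trans (∑-lookup≡∣∣ S) (sym (nC1≡n ∣ S ∣))))
                          (nCk+nC[k+1]≡[n+1]C[k+1] ∣ S ∣ 1)
  new-pairs false = cong (_+ ∣ S ∣ C 2) (∑-zero (allFin n))

-- Edges and cliques

≤-foldr-⊔ : {A : Set} (f : A → ℕ) {x : A} {xs : List A} → x ∈ xs → f x ≤ foldr (λ y m → f y ⊔ m) 0 xs
≤-foldr-⊔ f (here refl)         = m≤m⊔n (f _) _
≤-foldr-⊔ f {xs = y ∷ _} (there x∈xs) = ≤-trans (≤-foldr-⊔ f x∈xs) (m≤n⊔m (f y) _)

module _ {n : ℕ} (G : Graph n) where

  Δ : ℕ
  Δ = maxDegree G

  edge : Fin n → Fin n → Bool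
  edge i j = (toℕ i <ᵇ toℕ j) ∧ adj G i j

  numEdges≡∑edge : numEdges G ≡ ∑[ i ∈ allFin n ] ∑[ j ∈ allFin n ] ⟦ edge i j ⟧
  numEdges≡∑edge = trans (length-filter≡∑ _ (cartesianProduct (allFin n) (allFin n)))
                         (∑-cartesianProduct (allFin n) (allFin n) (λ (i , j) → ⟦ edge i j ⟧))

  degree≡∑adj : ∀ v → degree G v ≡ ∑[ u ∈ allFin n ] ⟦ adj G v u ⟧
  degree≡∑adj v = length-filter≡∑ (λ u → T? (adj G v u)) (allFin n)

  degree≤Δ : ∀ v → degree G v ≤ Δ
  degree≤Δ v = ≤-foldr-⊔ (degree G) (∈-allFin v)

  edge+edge≤adj : ∀ i j → ⟦ edge i j ⟧ + ⟦ edge j i ⟧ ≤ ⟦ adj G i j ⟧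
  edge+edge≤adj i j with toℕ i <ᵇ toℕ j in i<j | toℕ j <ᵇ toℕ i in j<i
  ... | true  | true  = contradiction (<ᵇ⇒< (toℕ j) (toℕ i) (T-≡ .from j<i)) (<-asym (<ᵇ⇒< (toℕ i) (toℕ j) (T-≡ .from i<j)))
  ... | true  | false = ≤-reflexive (+-identityʳ _)
  ... | false | true  = ≤-reflexive (cong ⟦_⟧ (symm G j i))
  ... | false | false = z≤n

  handshake : 2 * numEdges G ≤ n * Δ
  handshake = begin
    2 * numEdges G                                            ≡⟨ cong (2 *_) numEdges≡∑edge ⟩
    2 * E                                                     ≡⟨ cong (E +_) (+-identityʳ E) ⟩
    E + E                                                     ≡⟨ cong (E +_) (∑-comm (allFin n) (allFin n) (λ i j → ⟦ edge i j ⟧)) ⟩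
    E + ∑[ i ∈ allFin n ] ∑[ j ∈ allFin n ] ⟦ edge j i ⟧      ≡⟨ ∑-distrib-+ (allFin n) _ _ ⟨
    ∑[ i ∈ allFin n ] (∑[ j ∈ allFin n ] ⟦ edge i j ⟧ + ∑[ j ∈ allFin n ] ⟦ edge j i ⟧)
      ≡⟨ ∑-cong (allFin n) (λ i → ∑-distrib-+ (allFin n) (λ j → ⟦ edge i j ⟧) (λ j → ⟦ edge j i ⟧)) ⟨
    ∑[ i ∈ allFin n ] ∑[ j ∈ allFin n ] (⟦ edge i j ⟧ + ⟦ edge j i ⟧)
      ≤⟨ ∑-mono-≤ (allFin n) (λ i → ∑-mono-≤ (allFin n) (edge+edge≤adj i)) ⟩
    ∑[ i ∈ allFin n ] ∑[ j ∈ allFin n ] ⟦ adj G i j ⟧        ≡⟨ ∑-cong (allFin n) degree≡∑adj ⟨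
    ∑[ i ∈ allFin n ] degree G i                              ≤⟨ ∑-mono-≤ (allFin n) degree≤Δ ⟩
    ∑[ i ∈ allFin n ] Δ                                       ≡⟨ ∑-const (allFin n) Δ ⟩
    length (allFin n) * Δ                                     ≡⟨ cong (_* Δ) (length-tabulate {n = n} (λ i → i)) ⟩
    n * Δ                                                     ∎
    where
    open ≤-Reasoning
    E : ℕ
    E = ∑[ i ∈ allFin n ] ∑[ j ∈ allFin n ] ⟦ edge i j ⟧

  clique? : Subset n → Bool
  clique? S = does (isClique? G S)

  cliqueOfSize : ℕ → Subset n → Bool
  cliqueOfSize k S = clique? S ∧ (∣ S ∣ ≡ᵇ k)

  #cliquesOfSize : ℕ → ℕ
  #cliquesOfSize k = ∑[ S ∈ allSubsets n ] ⟦ cliqueOfSize k S ⟧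

  numCliques≡∑#cliquesOfSize : numCliques G ≡ ∑[ k ∈ upTo (suc n) ] #cliquesOfSize k
  numCliques≡∑#cliquesOfSize = begin
    numCliques G                                                    ≡⟨ length-filter≡∑ (isClique? G) (allSubsets n) ⟩
    ∑[ S ∈ allSubsets n ] ⟦ clique? S ⟧                             ≡⟨ ∑-cong (allSubsets n) (λ S → ∑-upTo-∧≡ᵇ (clique? S) (s≤s (∣p∣≤n S))) ⟨
    ∑[ S ∈ allSubsets n ] ∑[ k ∈ upTo (suc n) ] ⟦ cliqueOfSize k S ⟧ ≡⟨ ∑-comm (allSubsets n) (upTo (suc n)) (λ S k → ⟦ cliqueOfSize k S ⟧) ⟩
    ∑[ k ∈ upTo (suc n) ] #cliquesOfSize k                          ∎
    where open ≡-Reasoning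

  #cliquesOfSize≤C : ∀ k → #cliquesOfSize k ≤ n C k
  #cliquesOfSize≤C k = ≤-trans (∑-mono-≤ (allSubsets n) (λ S → ⟦⟧-mono-≤ (λ c → proj₂ (T-∧ .to c))))
                               (≤-reflexive (∑-∣∣≡C n k))

  clique⇒adj : ∀ {S u v} → T (clique? S) → T (lookup S u) → T (lookup S v) → u ≢ v → T (adj G u v)
  clique⇒adj {S} {u} {v} c u∈S v∈S =
    toWitness {a? = isClique? G S} (subst T (sym (isYes≗does (isClique? G S))) c)
              u v (lookup⇒[]= u S (T-≡ .to u∈S)) (lookup⇒[]= v S (T-≡ .to v∈S))

  adj⇒≢ : ∀ {i j} → T (adj G i j) → i ≢ j
  adj⇒≢ {i} i~j refl = subst T (irrefl G i) i~j

  module _ {i j : Fin n} where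

    edgeMode : Fin n → Mode
    edgeMode l = if does (l ≟ i) ∨ does (l ≟ j) then required
                 else if adj G i l ∧ adj G j l then optional else excluded

    edgePattern : Pattern n
    edgePattern = tabulate edgeMode

    clique-admits-edgeMode : ∀ {S} → T (clique? S) → T (lookup S i) → T (lookup S j) →
                             ∀ l → T (admits (edgeMode l) (lookup S l))
    clique-admits-edgeMode {S} c i∈S j∈S l with l ≟ i | l ≟ j
    ... | yes refl | _        = i∈S
    ... | no _     | yes refl = j∈S
    ... | no l≢i   | no l≢j   with adj G i l in i~l | adj G j l in j~l | lookup S l in l∈S
    ...   | true  | true  | _     = _
    ...   | true  | false | false = _
    ...   | false | _     | false = _
    ...   | false | _     | true  = subst T i~l (clique⇒adj c i∈S (T-≡ .from l∈S) (l≢i ∘ sym))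
    ...   | true  | false | true  = subst T j~l (clique⇒adj c j∈S (T-≡ .from l∈S) (l≢j ∘ sym))

    module _ (i~j : T (adj G i j)) where

      #required-edgePattern : #required edgePattern ≡ 2
      #required-edgePattern = begin
        #required edgePattern                                             ≡⟨ countᵇ-tabulate isRequired edgeMode ⟩
        ∑[ l ∈ allFin n ] ⟦ isRequired (edgeMode l) ⟧                     ≡⟨ ∑-cong (allFin n) required-at ⟩
        ∑[ l ∈ allFin n ] (⟦ does (l ≟ i) ⟧ + ⟦ does (l ≟ j) ⟧)           ≡⟨ ∑-distrib-+ (allFin n) _ _ ⟩
        ∑[ l ∈ allFin n ] ⟦ does (l ≟ i) ⟧ + ∑[ l ∈ allFin n ] ⟦ does (l ≟ j) ⟧ ≡⟨ cong₂ _+_ (∑-allFin-≟ i) (∑-allFin-≟ j) ⟩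
        2                                                                 ∎
        where
        open ≡-Reasoning
        required-at : ∀ l → ⟦ isRequired (edgeMode l) ⟧ ≡ ⟦ does (l ≟ i) ⟧ + ⟦ does (l ≟ j) ⟧
        required-at l with l ≟ i | l ≟ j
        ... | yes l≡i | yes l≡j = contradiction (trans (sym l≡i) l≡j) (adj⇒≢ i~j)
        ... | yes _   | no _    = refl
        ... | no _    | yes _   = refl
        ... | no _    | no _    with adj G i l ∧ adj G j l
        ...   | true  = refl
        ...   | false = refl

      #optional-edgePattern≤Δ∸1 : #optional edgePattern ≤ Δ ∸ 1
      #optional-edgePattern≤Δ∸1 = m+n≤o⇒m≤o∸n (#optional edgePattern) (begin
        #optional edgePattern + 1
          ≡⟨ cong₂ _+_ (countᵇ-tabulate isOptional edgeMode) (sym (∑-allFin-≟ j)) ⟩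
        ∑[ l ∈ allFin n ] ⟦ isOptional (edgeMode l) ⟧ + ∑[ l ∈ allFin n ] ⟦ does (l ≟ j) ⟧
          ≡⟨ ∑-distrib-+ (allFin n) _ _ ⟨
        ∑[ l ∈ allFin n ] (⟦ isOptional (edgeMode l) ⟧ + ⟦ does (l ≟ j) ⟧)
          ≤⟨ ∑-mono-≤ (allFin n) optional-at ⟩
        ∑[ l ∈ allFin n ] ⟦ adj G i l ⟧  ≡⟨ degree≡∑adj i ⟨
        degree G i                       ≤⟨ degree≤Δ i ⟩
        Δ                                ∎)
        where
        open ≤-Reasoning
        optional-at : ∀ l → ⟦ isOptional (edgeMode l) ⟧ + ⟦ does (l ≟ j) ⟧ ≤ ⟦ adj G i l ⟧
        optional-at l with l ≟ i | l ≟ j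
        ... | yes l≡i | yes l≡j = contradiction (trans (sym l≡i) l≡j) (adj⇒≢ i~j)
        ... | yes _   | no _    = z≤n
        ... | no _    | yes refl = ≤-reflexive (cong ⟦_⟧ (sym (T-≡ .to i~j)))
        ... | no _    | no _    with adj G i l | adj G j l
        ...   | true  | true  = ≤-refl
        ...   | true  | false = z≤n
        ...   | false | _     = z≤n

      cliqueOfSize⇒fits-edgePattern : ∀ k S → T (cliqueOfSize k S ∧ (lookup S i ∧ lookup S j)) →
                                      T (fits edgePattern S ∧ (∣ S ∩optional edgePattern ∣ ≡ᵇ k ∸ 2))
      cliqueOfSize⇒fits-edgePattern k S h = T-∧ .from (S-fits , ≡⇒≡ᵇ _ _ size)
        where
        open ≡-Reasoning
        clique-k : T (cliqueOfSize k S)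
        clique-k = proj₁ (T-∧ {cliqueOfSize k S} .to h)
        ij∈S : T (lookup S i ∧ lookup S j)
        ij∈S = proj₂ (T-∧ {cliqueOfSize k S} .to h)
        S-fits : T (fits edgePattern S)
        S-fits = fits-tabulate edgeMode S (clique-admits-edgeMode (proj₁ (T-∧ {clique? S} .to clique-k))
                                                                  (proj₁ (T-∧ {lookup S i} .to ij∈S))
                                                                  (proj₂ (T-∧ {lookup S i} .to ij∈S)))
        size : ∣ S ∩optional edgePattern ∣ ≡ k ∸ 2
        size = begin
          ∣ S ∩optional edgePattern ∣                           ≡⟨ m+n∸m≡n 2 _ ⟨
          2 + ∣ S ∩optional edgePattern ∣ ∸ 2                   ≡⟨ cong (λ r → r + ∣ S ∩optional edgePattern ∣ ∸ 2) #required-edgePattern ⟨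
          #required edgePattern + ∣ S ∩optional edgePattern ∣ ∸ 2 ≡⟨ cong (_∸ 2) (fits⇒∣S∣≡#required+∣S∩optional∣ edgePattern S S-fits) ⟨
          ∣ S ∣ ∸ 2                                             ≡⟨ cong (_∸ 2) (≡ᵇ⇒≡ ∣ S ∣ k (proj₂ (T-∧ {clique? S} .to clique-k))) ⟩
          k ∸ 2                                                 ∎

      #cliquesOfSizeThroughEdge≤ : ∀ k →
        ∑[ S ∈ allSubsets n ] ⟦ cliqueOfSize k S ∧ (lookup S i ∧ lookup S j) ⟧ ≤ (Δ ∸ 1) C (k ∸ 2)
      #cliquesOfSizeThroughEdge≤ k = begin
        ∑[ S ∈ allSubsets n ] ⟦ cliqueOfSize k S ∧ (lookup S i ∧ lookup S j) ⟧
          ≤⟨ ∑-mono-≤ (allSubsets n) (λ S → ⟦⟧-mono-≤ (cliqueOfSize⇒fits-edgePattern k S)) ⟩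
        ∑[ S ∈ allSubsets n ] ⟦ fits edgePattern S ∧ (∣ S ∩optional edgePattern ∣ ≡ᵇ k ∸ 2) ⟧
          ≡⟨ ∑-fits≡C edgePattern (k ∸ 2) ⟩
        #optional edgePattern C (k ∸ 2)
          ≤⟨ C-monoˡ-≤ (k ∸ 2) #optional-edgePattern≤Δ∸1 ⟩
        (Δ ∸ 1) C (k ∸ 2) ∎
        where open ≤-Reasoning

  ordered-pair⇒edge : ∀ {S} → T (clique? S) → ∀ i j →
    T ((toℕ i <ᵇ toℕ j) ∧ (lookup S i ∧ lookup S j)) → T (edge i j ∧ (lookup S i ∧ lookup S j))
  ordered-pair⇒edge {S} c i j h = T-∧ .from (T-∧ .from (i<j , clique⇒adj c i∈S j∈S i≢j) , ij∈S)
    where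
    i<j : T (toℕ i <ᵇ toℕ j)
    i<j = proj₁ (T-∧ {toℕ i <ᵇ toℕ j} .to h)
    ij∈S : T (lookup S i ∧ lookup S j)
    ij∈S = proj₂ (T-∧ {toℕ i <ᵇ toℕ j} .to h)
    i∈S : T (lookup S i)
    i∈S = proj₁ (T-∧ {lookup S i} .to ij∈S)
    j∈S : T (lookup S j)
    j∈S = proj₂ (T-∧ {lookup S i} .to ij∈S)
    i≢j : i ≢ j
    i≢j refl = <-irrefl refl (<ᵇ⇒< (toℕ i) (toℕ i) i<j)

  [k]C2≤#edgesInClique : ∀ k S → (k C 2) * ⟦ cliqueOfSize k S ⟧ ≤
    ∑[ i ∈ allFin n ] ∑[ j ∈ allFin n ] (⟦ edge i j ⟧ * ⟦ cliqueOfSize k S ∧ (lookup S i ∧ lookup S j) ⟧)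
  [k]C2≤#edgesInClique k S with cliqueOfSize k S in S-clique-k
  ... | false = ≤-trans (≤-reflexive (*-zeroʳ (k C 2))) z≤n
  ... | true  = begin
    (k C 2) * 1                                                                        ≡⟨ *-identityʳ (k C 2) ⟩
    k C 2                                                                              ≡⟨ cong (_C 2) ∣S∣≡k ⟨
    ∣ S ∣ C 2                                                                          ≡⟨ ∑-pairs≡∣∣C2 S ⟨
    ∑[ i ∈ allFin n ] ∑[ j ∈ allFin n ] ⟦ (toℕ i <ᵇ toℕ j) ∧ (lookup S i ∧ lookup S j) ⟧
      ≤⟨ ∑-mono-≤ (allFin n) (λ i → ∑-mono-≤ (allFin n) (λ j → ⟦⟧-mono-≤ (ordered-pair⇒edge S-clique i j))) ⟩
    ∑[ i ∈ allFin n ] ∑[ j ∈ allFin n ] ⟦ edge i j ∧ (lookup S i ∧ lookup S j) ⟧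
      ≡⟨ ∑-cong (allFin n) (λ i → ∑-cong (allFin n) (λ j → ⟦∧⟧≡* (edge i j) _)) ⟩
    ∑[ i ∈ allFin n ] ∑[ j ∈ allFin n ] (⟦ edge i j ⟧ * ⟦ lookup S i ∧ lookup S j ⟧) ∎
    where
    open ≤-Reasoning
    S-clique : T (clique? S)
    S-clique = proj₁ (T-∧ {clique? S} .to (T-≡ .from S-clique-k))
    ∣S∣≡k : ∣ S ∣ ≡ k
    ∣S∣≡k = ≡ᵇ⇒≡ ∣ S ∣ k (proj₂ (T-∧ {clique? S} .to (T-≡ .from S-clique-k)))

  [k]C2*#cliquesOfSize≤ : ∀ k → (k C 2) * #cliquesOfSize k ≤ numEdges G * ((Δ ∸ 1) C (k ∸ 2))
  [k]C2*#cliquesOfSize≤ k = begin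
    (k C 2) * #cliquesOfSize k
      ≡⟨ ∑-*ˡ (allSubsets n) (k C 2) (λ S → ⟦ cliqueOfSize k S ⟧) ⟨
    ∑[ S ∈ allSubsets n ] ((k C 2) * ⟦ cliqueOfSize k S ⟧)
      ≤⟨ ∑-mono-≤ (allSubsets n) ([k]C2≤#edgesInClique k) ⟩
    ∑[ S ∈ allSubsets n ] ∑[ i ∈ allFin n ] ∑[ j ∈ allFin n ] (⟦ edge i j ⟧ * through S i j)
      ≡⟨ ∑-comm (allSubsets n) (allFin n) _ ⟩
    ∑[ i ∈ allFin n ] ∑[ S ∈ allSubsets n ] ∑[ j ∈ allFin n ] (⟦ edge i j ⟧ * through S i j)
      ≡⟨ ∑-cong (allFin n) (λ i → ∑-comm (allSubsets n) (allFin n) _) ⟩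
    ∑[ i ∈ allFin n ] ∑[ j ∈ allFin n ] ∑[ S ∈ allSubsets n ] (⟦ edge i j ⟧ * through S i j)
      ≡⟨ ∑-cong (allFin n) (λ i → ∑-cong (allFin n) (λ j → ∑-*ˡ (allSubsets n) ⟦ edge i j ⟧ (λ S → through S i j))) ⟩
    ∑[ i ∈ allFin n ] ∑[ j ∈ allFin n ] (⟦ edge i j ⟧ * ∑[ S ∈ allSubsets n ] through S i j)
      ≤⟨ ∑-mono-≤ (allFin n) (λ i → ∑-mono-≤ (allFin n) (λ j → ⟦⟧*-monoʳ-≤ (edge i j)
           (λ e → #cliquesOfSizeThroughEdge≤ (proj₂ (T-∧ {toℕ i <ᵇ toℕ j} .to e)) k))) ⟩
    ∑[ i ∈ allFin n ] ∑[ j ∈ allFin n ] (⟦ edge i j ⟧ * c)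
      ≡⟨ ∑-cong (allFin n) (λ i → ∑-*ʳ (allFin n) (λ j → ⟦ edge i j ⟧) c) ⟩
    ∑[ i ∈ allFin n ] (∑[ j ∈ allFin n ] ⟦ edge i j ⟧ * c)
      ≡⟨ ∑-*ʳ (allFin n) (λ i → ∑[ j ∈ allFin n ] ⟦ edge i j ⟧) c ⟩
    (∑[ i ∈ allFin n ] ∑[ j ∈ allFin n ] ⟦ edge i j ⟧) * c
      ≡⟨ cong (_* c) numEdges≡∑edge ⟨
    numEdges G * c ∎
    where
    open ≤-Reasoning
    c : ℕ
    c = (Δ ∸ 1) C (k ∸ 2)
    through : Subset n → Fin n → Fin n → ℕ
    through S i j = ⟦ cliqueOfSize k S ∧ (lookup S i ∧ lookup S j) ⟧

∑-C[2+k]≤2^[1+D]∸D∸2 : ∀ D K → ∑[ k ∈ upTo K ] (suc D C (2 + k)) ≤ 2 ^ suc D ∸ D ∸ 2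
∑-C[2+k]≤2^[1+D]∸D∸2 D K = subst (Σ ≤_) (sym (∸-+-assoc (2 ^ suc D) D 2)) (m+n≤o⇒m≤o∸n Σ (begin
  Σ + (D + 2)  ≡⟨ cong (Σ +_) (+-comm D 2) ⟩
  Σ + (2 + D)  ≡⟨ +-comm Σ (2 + D) ⟩
  2 + D + Σ    ≤⟨ 2+n+∑C[2+k]≤2^[1+n] D K ⟩
  2 ^ suc D    ∎))
  where
  open ≤-Reasoning
  Σ : ℕ
  Σ = ∑[ k ∈ upTo K ] (suc D C (2 + k))

2^[1+D]∸D∸2+[1+D]≡2^[1+D]∸1 : ∀ D → 2 ^ suc D ∸ D ∸ 2 + suc D ≡ 2 ^ suc D ∸ 1
2^[1+D]∸D∸2+[1+D]≡2^[1+D]∸1 D = begin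
  2 ^ suc D ∸ D ∸ 2 + suc D                  ≡⟨ cong (_+ suc D) (∸-+-assoc (2 ^ suc D) D 2) ⟩
  2 ^ suc D ∸ (D + 2) + suc D                ≡⟨ cong (λ x → 2 ^ suc D ∸ x + suc D) (+-comm D 2) ⟩
  2 ^ suc D ∸ (2 + D) + suc D                ≡⟨ +-∸-assoc (2 ^ suc D ∸ (2 + D)) (s≤s (z≤n {suc D})) ⟨
  2 ^ suc D ∸ (2 + D) + (2 + D) ∸ 1          ≡⟨ cong (_∸ 1) (m∸n+n≡m 2+D≤2^[1+D]) ⟩
  2 ^ suc D ∸ 1                              ∎
  where
  open ≡-Reasoning
  2+D≤2^[1+D] : 2 + D ≤ 2 ^ suc D
  2+D≤2^[1+D] = subst (_≤ 2 ^ suc D) (+-identityʳ (2 + D)) (2+n+∑C[2+k]≤2^[1+n] D 0)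

[2+d]C2*c≤ : ∀ d k {m c} → ((2 + k) C 2) * c ≤ m * (d C k) → ((2 + d) C 2) * c ≤ m * ((2 + d) C (2 + k))
[2+d]C2*c≤ d k {m} {c} K*c≤ = *-cancelˡ-≤ K {{>-nonZero (0<[k+2]C2 k)}} (begin
  K * (B * c)                   ≡⟨ x∙yz≈y∙xz K B c ⟩
  B * (K * c)                   ≤⟨ *-monoʳ-≤ B K*c≤ ⟩
  B * (m * (d C k))             ≡⟨ x∙yz≈y∙xz B m (d C k) ⟩
  m * (B * (d C k))             ≡⟨ cong (m *_) ([n+2]C2*nCk≡[k+2]C2*[n+2]C[k+2] d k) ⟩
  m * (K * ((2 + d) C (2 + k))) ≡⟨ x∙yz≈y∙xz m K ((2 + d) C (2 + k)) ⟩
  K * (m * ((2 + d) C (2 + k))) ∎)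
  where
  open ≤-Reasoning
  K B : ℕ
  K = (2 + k) C 2
  B = (2 + d) C 2

clique-bound : ∀ {D} n m (c : ℕ → ℕ) → 1 ≤ D →
  (∀ k → c k ≤ n C k) → (∀ k → (k C 2) * c k ≤ m * ((D ∸ 1) C (k ∸ 2))) →
  ((1 + D) C 2) * ∑[ k ∈ upTo (suc n) ] c k ≤ ((1 + D) C 2) * (1 + n) + (2 ^ (1 + D) ∸ D ∸ 2) * m
-- Padding the range of sizes to 2 + n exposes the terms k = 0 and k = 1 also when n = 0.
clique-bound {suc d} n m c _ c≤C C2*c≤ = begin
  b * ∑[ k ∈ upTo (suc n) ] c k                            ≡⟨ ∑-*ˡ (upTo (suc n)) b c ⟨
  ∑[ k ∈ upTo (suc n) ] (b * c k)                          ≤⟨ ∑-upTo-≤-suc (suc n) (λ k → b * c k) ⟩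
  ∑[ k ∈ upTo (2 + n) ] (b * c k)                          ≡⟨ ∑-upTo-suc (suc n) (λ k → b * c k) ⟩
  b * c 0 + ∑[ k ∈ upTo (suc n) ] (b * c (suc k))         ≡⟨ cong (b * c 0 +_) (∑-upTo-suc n (λ k → b * c (suc k))) ⟩
  b * c 0 + (b * c 1 + ∑[ k ∈ upTo n ] (b * c (2 + k)))
    ≤⟨ +-mono-≤ (*-monoʳ-≤ b (c≤C 0)) (+-mono-≤ (*-monoʳ-≤ b (≤-trans (c≤C 1) (≤-reflexive (nC1≡n n))))
                                                (∑-mono-≤ (upTo n) (λ k → [2+d]C2*c≤ d k {m} (C2*c≤ (2 + k))))) ⟩
  b * 1 + (b * n + ∑[ k ∈ upTo n ] (m * (N C (2 + k))))   ≡⟨ cong (λ x → b * 1 + (b * n + x)) (∑-*ˡ (upTo n) m (λ k → N C (2 + k))) ⟩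
  b * 1 + (b * n + m * ∑[ k ∈ upTo n ] (N C (2 + k)))     ≤⟨ +-monoʳ-≤ (b * 1) (+-monoʳ-≤ (b * n) (*-monoʳ-≤ m (∑-C[2+k]≤2^[1+D]∸D∸2 (suc d) n))) ⟩
  b * 1 + (b * n + m * a)                                 ≡⟨ +-assoc (b * 1) (b * n) (m * a) ⟨
  b * 1 + b * n + m * a                                   ≡⟨ cong₂ _+_ (*-distribˡ-+ b 1 n) (*-comm a m) ⟨
  b * (1 + n) + a * m                                     ∎
  where
  open ≤-Reasoning
  N b a : ℕ
  N = 2 + d
  b = N C 2
  a = 2 ^ N ∸ suc d ∸ 2

linear-bound : ∀ {D} n m → 1 ≤ D → 2 * m ≤ n * D →
  (1 + D) * (((1 + D) C 2) * (1 + n) + (2 ^ (1 + D) ∸ D ∸ 2) * m)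
    ≤ ((1 + D) C 2) * ((1 + D) + (2 ^ (1 + D) ∸ 1) * n)
linear-bound {suc d} n m _ 2m≤nD = begin
  N * (b * (1 + n) + a * m)          ≡⟨ expand N b n a m ⟩
  N * b + N * b * n + a * (N * m)    ≤⟨ +-monoʳ-≤ (N * b + N * b * n) (*-monoʳ-≤ a Nm≤bn) ⟩
  N * b + N * b * n + a * (b * n)    ≡⟨ collect N b n a ⟩
  b * (N + (a + N) * n)              ≡⟨ cong (λ x → b * (N + x * n)) (2^[1+D]∸D∸2+[1+D]≡2^[1+D]∸1 (suc d)) ⟩
  b * (N + (2 ^ N ∸ 1) * n)          ∎
  where
  open ≤-Reasoning
  open +-*-Solver
  N b a : ℕ
  N = 2 + d
  b = N C 2
  a = 2 ^ N ∸ suc d ∸ 2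
  expand : ∀ N b n a m → N * (b * (1 + n) + a * m) ≡ N * b + N * b * n + a * (N * m)
  expand = solve 5 (λ N b n a m → N :* (b :* (con 1 :+ n) :+ a :* m) := N :* b :+ N :* b :* n :+ a :* (N :* m)) refl
  collect : ∀ N b n a → N * b + N * b * n + a * (b * n) ≡ b * (N + (a + N) * n)
  collect = solve 4 (λ N b n a → N :* b :+ N :* b :* n :+ a :* (b :* n) := b :* (N :+ (a :+ N) :* n)) refl
  Nm≤bn : N * m ≤ b * n
  Nm≤bn = *-cancelˡ-≤ 2 (begin
    2 * (N * m)        ≡⟨ x∙yz≈y∙xz 2 N m ⟩
    N * (2 * m)        ≤⟨ *-monoʳ-≤ N 2m≤nD ⟩
    N * (n * suc d)    ≡⟨ x∙yz≈y∙xz N n (suc d) ⟩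
    n * (N * suc d)    ≡⟨ cong (n *_) (2*[n+2]C2≡[n+2]*[n+1] d) ⟨
    n * (2 * b)        ≡⟨ x∙yz≈y∙xz n 2 b ⟩
    2 * (n * b)        ≡⟨ cong (2 *_) (*-comm n b) ⟩
    2 * (b * n)        ∎)

theorem3 : (n : ℕ) (G : Graph n) → 1 ≤ maxDegree G →
    (((1 + maxDegree G) C 2) * numCliques G
       ≤ ((1 + maxDegree G) C 2) * (1 + n) + (2 ^ (1 + maxDegree G) ∸ maxDegree G ∸ 2) * numEdges G)
    × ((1 + maxDegree G) * (((1 + maxDegree G) C 2) * (1 + n) + (2 ^ (1 + maxDegree G) ∸ maxDegree G ∸ 2) * numEdges G)
       ≤ ((1 + maxDegree G) C 2) * ((1 + maxDegree G) + (2 ^ (1 + maxDegree G) ∸ 1) * n))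
theorem3 n G 1≤Δ =
    ≤-trans (≤-reflexive (cong (((1 + Δ G) C 2) *_) (numCliques≡∑#cliquesOfSize G)))
            (clique-bound n (numEdges G) (#cliquesOfSize G) 1≤Δ (#cliquesOfSize≤C G) ([k]C2*#cliquesOfSize≤ G))
  , linear-bound n (numEdges G) 1≤Δ (handshake G)
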